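{- Let $n\ge2$, identify $\mathrm{Free}_n(\mathbf{CH})$ with $G_n^+$ (with free generators $x_1,\ldots,x_n$), and let $\sigma$ be a nontrivial endomorphism of $\mathrm{Free}_n(\mathbf{CH})$. Let $f_i=\sigma(x_i)$ for $1\le i\le n$, let $f_\sharp=f_n+(f_1\lor\cdots\lor f_{n-1})=\sigma(\mathbf{1})$, and let $S:[0,1]^{n-1}\to[0,1]^{n-1}$ be $S(p)=(f_1(p)/f_\sharp(p),\ldots,f_{n-1}(p)/f_\sharp(p))$. Then, for every $f\in\mathrm{Free}_n(\mathbf{CH})$, we have $\sigma(f)=f_\sharp\cdot(f\circ S)$.
   Context: A cancellative hoop is an algebra $(A,+,\mathbin{\dot{ - }},0)$ with $\mathbin{\dot{ - }}$ a truncated difference (on positive cones of $\ell$-groups, $a\mathbin{\dot{ - }}b=0\lor(a-b)$); $\mathrm{Free}_n(\mathbf{CH})$ is the free cancellative hoop on $n$ generators. $G_n$ is the $\ell$-group of all McNaughton functions $[0,1]^{n-1}\to\mathbb{R}$ (enveloping the free MV-algebra on $n-1$ generators, with strong unit $\mathbf{1}$, the constant function $1$); $x_1,\ldots,x_{n-1}$ are the coordinate projections and $x_n=\mathbf{1}-(x_1\lor\cdots\lor x_{n-1})$; $\mathrm{Free}_n(\mathbf{CH})\cong G_n^+$ with free generators $x_1,\ldots,x_n$. An endomorphism is nontrivial if it maps strong units to strong units (equivalently its image lies in no maximal ideal); in particular $f_\sharp$ never vanishes. $S$ is the dual map of $\sigma$ on the maximal spectrum identified with $[0,1]^{n-1}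$.
   Formalization: McNaughton functions are represented by their values at the rational points of $[0,1]^{n-1}$, and the identity $\sigma(f)=f_\sharp\cdot(f\circ S)$ is asserted only at those points. -}

module Defs where

open import Data.Nat as ℕ using (ℕ; zero; suc)
open import Data.Fin using (Fin) renaming (zero to fzero; suc to fsuc)
open import Data.Integer as ℤ using (ℤ)
open import Data.Product using (Σ; ∃; ∃-syntax; _×_; _,_)
open import Data.List using (List)
open import Data.List.Membership.Propositional using (_∈_)
open import Relation.Nullary using (yes; no)
open import Relation.Binary.PropositionalEquality using (_≡_)
open import Data.Rational as ℚ
  using (ℚ; ≢-nonZero; 0ℚ; 1ℚ; _+_; _*_; _-_; _≤_; _<_; _⊔_; ∣_∣; _÷_)
open import Data.Rational.Properties using (_≟_)

Point : ℕ → Set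
Point d = Fin d → ℚ

InCube : ∀ {d} → Point d → Set
InCube p = ∀ i → (0ℚ ≤ p i) × (p i ≤ 1ℚ)

-- finite sum and finite join (join starts from 0; all uses are on
-- nonnegative values)
Σℚ : ∀ {d} → (Fin d → ℚ) → ℚ
Σℚ {zero}  f = 0ℚ
Σℚ {suc d} f = f fzero + Σℚ (λ i → f (fsuc i))

⋁ℚ : ∀ {d} → (Fin d → ℚ) → ℚ
⋁ℚ {zero}  f = 0ℚ
⋁ℚ {suc d} f = f fzero ⊔ ⋁ℚ (λ i → f (fsuc i))

Fun : ℕ → Set
Fun d = Point d → ℚ

-- McNaughton functions: continuous (uniformly, on the rational cube)
-- and piecewise linear with finitely many linear pieces with integer
-- coefficients.

record Affine (d : ℕ) : Set where
  constructor affine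
  field
    coeff    : Fin d → ℤ
    constant : ℤ

evalAffine : ∀ {d} → Affine d → Point d → ℚ
evalAffine (affine c b) p = Σℚ (λ i → (c i ℚ./ 1) * p i) + (b ℚ./ 1)

PiecewiseIntegerLinear : ∀ {d} → Fun d → Set
PiecewiseIntegerLinear {d} f =
  ∃[ pieces ] (∀ p → InCube p → ∃[ a ] (a ∈ pieces × f p ≡ evalAffine {d} a p))

UniformlyContinuous : ∀ {d} → Fun d → Set
UniformlyContinuous {d} f =
  ∀ ε → 0ℚ < ε → ∃[ δ ] (0ℚ < δ × (∀ (p q : Point d) → InCube p → InCube q →
     (∀ i → ∣ p i - q i ∣ < δ) → ∣ f p - f q ∣ < ε))

IsMcNaughton : ∀ {d} → Fun d → Set
IsMcNaughton f = PiecewiseIntegerLinear f × UniformlyContinuous f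

-- membership in the positive cone G_n^+ (n = d + 1)
InG⁺ : ∀ {d} → Fun d → Set
InG⁺ f = IsMcNaughton f × (∀ p → InCube p → 0ℚ ≤ f p)

_≈_ : ∀ {d} → Fun d → Fun d → Set
f ≈ g = ∀ p → InCube p → f p ≡ g p

𝟎 : ∀ {d} → Fun d
𝟎 _ = 0ℚ

𝟏 : ∀ {d} → Fun d
𝟏 _ = 1ℚ

_⊕_ : ∀ {d} → Fun d → Fun d → Fun d
(f ⊕ g) p = f p + g p

_⊝_ : ∀ {d} → Fun d → Fun d → Fun d
(f ⊝ g) p = 0ℚ ⊔ (f p - g p)

-- the free generators x_1 … x_n of Free_n(CH) ≅ G_n^+  (d = n - 1)
xᵢ : ∀ {d} → Fin d → Fun d
xᵢ i p = p i

xₙ : ∀ {d} → Fun d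
xₙ p = 1ℚ - ⋁ℚ p

IsStrongUnit : ∀ {d} → Fun d → Set
IsStrongUnit u = ∃[ k ] (∀ p → InCube p → 1ℚ ≤ (ℤ.+ k ℚ./ 1) * u p)

-- an endomorphism of the cancellative hoop G_n^+, given by its action on
-- (representatives of) elements of G_n^+
record IsHoopEndo {d} (σ : Fun d → Fun d) : Set where
  field
    closed  : ∀ f → InG⁺ f → InG⁺ (σ f)
    cong    : ∀ f g → InG⁺ f → InG⁺ g → f ≈ g → σ f ≈ σ g
    pres-0  : σ 𝟎 ≈ 𝟎
    pres-+  : ∀ f g → InG⁺ f → InG⁺ g → σ (f ⊕ g) ≈ (σ f ⊕ σ g)
    pres-∸  : ∀ f g → InG⁺ f → InG⁺ g → σ (f ⊝ g) ≈ (σ f ⊝ σ g)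

IsNontrivial : ∀ {d} → (Fun d → Fun d) → Set
IsNontrivial σ = ∀ u → InG⁺ u → IsStrongUnit u → IsStrongUnit (σ u)

-- division, with an (irrelevant) fallback value 0 when dividing by 0;
-- for nontrivial σ, f_♯ never vanishes on the cube, so the fallback is
-- never used at points of the cube.
_/'_ : ℚ → ℚ → ℚ
a /' b with b ≟ 0ℚ
... | yes _  = 0ℚ
... | no b≢0 = _÷_ a b {{≢-nonZero b≢0}}

f♯ : ∀ {d} → (Fun d → Fun d) → Fun d
f♯ σ p = σ xₙ p + ⋁ℚ (λ i → σ (xᵢ i) p)

S : ∀ {d} → (Fun d → Fun d) → Point d → Point d
S σ p i = σ (xᵢ i) p /' f♯ σ p

-- Fix p in the cube. Then φ f = σ f p is a hoop homomorphism from G⁺ to ℚ,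
-- φ 𝟏 = f♯(p) is positive because σ is nontrivial, and q = S(p) satisfies
-- φ xᵢ = f♯(p) · qᵢ; so it suffices that every such φ is f♯(p) times evaluation at q.
-- As q is rational, qᵢ = mᵢ / Nᵢ, and h = Σᵢ |Nᵢ xᵢ - mᵢ| lies in G⁺, dominates the
-- ℓ¹ distance to q, and has φ h = Σᵢ |Nᵢ φ xᵢ - mᵢ φ 𝟏| = 0. A McNaughton function g
-- with g(q) = 0 is piecewise linear and continuous, hence g ≤ C · dist(-, q) ≤ L · h
-- for a natural number L, and φ g ≤ L · φ h = 0. Applied to f ⊝ g this yields
-- φ f ≤ φ g whenever f(q) ≤ g(q). Finally, if f(q) = m / N then N · f and m · 𝟏 agree
-- at q, so N · φ f = m · φ 𝟏 = N · f♯(p) · f(q).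

{-# OPTIONS --safe #-}
module Submission where

module McNaughtonCone where

  open import Data.Fin using (Fin) renaming (zero to fzero; suc to fsuc)
  open import Data.Integer as ℤ using (ℤ; +_; -[1+_])
  open import Data.Integer.Solver using (module +-*-Solver)
  open import Data.List using (List; []; _∷_; cartesianProductWith)
  open import Data.List.Membership.Propositional using (_∈_)
  open import Data.List.Membership.Propositional.Properties using (∈-cartesianProductWith⁺)
  open import Data.List.Relation.Unary.Any using (here; there)
  open import Data.Nat as ℕ using (ℕ; zero; suc)
  open import Data.Product using (∃; ∃-syntax; _×_; _,_; proj₁; proj₂)
  open import Data.Rational
  open import Data.Rational.Properties
  open import Data.Rational.Solver renaming (module +-*-Solver to ℚ-Solver)
  import Data.Rational.Unnormalised as ℚᵘ
  import Data.Rational.Unnormalised.Properties as ℚᵘ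
  open import Data.Sum using (inj₁; inj₂)
  open import Relation.Binary.PropositionalEquality
  open import Relation.Nullary using (yes; no; contradiction)
  open import Defs

  ι : ℤ → ℚ
  ι z = z / 1

  ιℕ : ℕ → ℚ
  ιℕ n = ι (+ n)

  toℚᵘ-ι : ∀ z → toℚᵘ (ι z) ℚᵘ.≃ z ℚᵘ./ 1
  toℚᵘ-ι z = toℚᵘ-fromℚᵘ (z ℚᵘ./ 1)

  ι-+ : ∀ i j → ι (i ℤ.+ j) ≡ ι i + ι j
  ι-+ i j = toℚᵘ-injective (begin
    toℚᵘ (ι (i ℤ.+ j))         ≈⟨ toℚᵘ-ι (i ℤ.+ j) ⟩
    (i ℤ.+ j) ℚᵘ./ 1           ≈⟨ ℚᵘ.*≡* (solve 2 (λ i j → (i :+ j) :* (con (+ 1) :* con (+ 1))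
                                     := (i :* con (+ 1) :+ j :* con (+ 1)) :* con (+ 1)) refl i j) ⟩
    i ℚᵘ./ 1 ℚᵘ.+ j ℚᵘ./ 1     ≈⟨ ℚᵘ.≃-sym (ℚᵘ.+-cong (toℚᵘ-ι i) (toℚᵘ-ι j)) ⟩
    toℚᵘ (ι i) ℚᵘ.+ toℚᵘ (ι j) ≈⟨ ℚᵘ.≃-sym (toℚᵘ-homo-+ (ι i) (ι j)) ⟩
    toℚᵘ (ι i + ι j)           ∎)
    where open ℚᵘ.≃-Reasoning
          open +-*-Solver

  ι-neg : ∀ z → ι (ℤ.- z) ≡ - ι z
  ι-neg z = toℚᵘ-injective (begin
    toℚᵘ (ι (ℤ.- z))  ≈⟨ toℚᵘ-ι (ℤ.- z) ⟩
    ℤ.- z ℚᵘ./ 1      ≈⟨ ℚᵘ.≃-sym (ℚᵘ.-‿cong (toℚᵘ-ι z)) ⟩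
    ℚᵘ.- toℚᵘ (ι z)   ≈⟨ ℚᵘ.≃-sym (toℚᵘ-homo‿- (ι z)) ⟩
    toℚᵘ (- ι z)      ∎)
    where open ℚᵘ.≃-Reasoning

  ↧*≡↥ : ∀ p → ιℕ (↧ₙ p) * p ≡ ι (↥ p)
  ↧*≡↥ p@record{} = toℚᵘ-injective (begin
    toℚᵘ (ιℕ (↧ₙ p) * p)          ≈⟨ toℚᵘ-homo-* (ιℕ (↧ₙ p)) p ⟩
    toℚᵘ (ιℕ (↧ₙ p)) ℚᵘ.* toℚᵘ p  ≈⟨ ℚᵘ.*-congʳ (toℚᵘ-ι (+ ↧ₙ p)) ⟩
    (+ ↧ₙ p ℚᵘ./ 1) ℚᵘ.* toℚᵘ p   ≈⟨ ℚᵘ.*≡* (solve 2 (λ n d → (d :* n) :* con (+ 1)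
                                                      := n :* (con (+ 1) :* d)) refl (↥ p) (+ ↧ₙ p)) ⟩
    ↥ p ℚᵘ./ 1                    ≈⟨ ℚᵘ.≃-sym (toℚᵘ-ι (↥ p)) ⟩
    toℚᵘ (ι (↥ p))                ∎)
    where open ℚᵘ.≃-Reasoning
          open +-*-Solver

  0≤ιℕ : ∀ n → 0ℚ ≤ ιℕ n
  0≤ιℕ n = nonNegative⁻¹ (ιℕ n) {{normalize-nonNeg n 1}}

  ιℕ-suc : ∀ n → ιℕ (suc n) ≡ 1ℚ + ιℕ n
  ιℕ-suc n = ι-+ (+ 1) (+ n)

  p+ιℕk*p≡ιℕ[1+k]*p : ∀ k p → p + ιℕ k * p ≡ ιℕ (suc k) * p
  p+ιℕk*p≡ιℕ[1+k]*p k p = begin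
    p + ιℕ k * p         ≡⟨ cong (_+ ιℕ k * p) (sym (*-identityˡ p)) ⟩
    1ℚ * p + ιℕ k * p    ≡⟨ sym (*-distribʳ-+ p 1ℚ (ιℕ k)) ⟩
    (1ℚ + ιℕ k) * p      ≡⟨ cong (_* p) (sym (ιℕ-suc k)) ⟩
    ιℕ (suc k) * p       ∎
    where open ≡-Reasoning

  1≤ιℕ-suc : ∀ n → 1ℚ ≤ ιℕ (suc n)
  1≤ιℕ-suc n = begin
    1ℚ          ≡⟨ sym (+-identityʳ 1ℚ) ⟩
    1ℚ + 0ℚ     ≤⟨ +-monoʳ-≤ 1ℚ (0≤ιℕ n) ⟩
    1ℚ + ιℕ n   ≡⟨ sym (ιℕ-suc n) ⟩
    ιℕ (suc n)  ∎
    where open ≤-Reasoning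

  nonNeg-fraction : ∀ p → 0ℚ ≤ p → ∃[ k ] ∃[ m ] ιℕ (suc k) * p ≡ ιℕ m
  nonNeg-fraction p@(mkℚ (+ m) k _) _  = k , m , ↧*≡↥ p
  nonNeg-fraction (mkℚ -[1+ _ ] _ _) (*≤* ())

  archimedean : ∀ p → ∃[ n ] p ≤ ιℕ n
  archimedean p with ≤-total p 0ℚ
  ... | inj₁ p≤0 = 0 , p≤0
  ... | inj₂ 0≤p with nonNeg-fraction p 0≤p
  ...   | k , m , fraction = m , (begin
    p                ≡⟨ sym (*-identityˡ p) ⟩
    1ℚ * p           ≤⟨ *-monoʳ-≤-nonNeg p {{nonNegative 0≤p}} (1≤ιℕ-suc k) ⟩
    ιℕ (suc k) * p   ≡⟨ fraction ⟩
    ιℕ m             ∎)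
    where open ≤-Reasoning

  *-cancelˡ-≡-pos : ∀ r {p q} .{{_ : Positive r}} → r * p ≡ r * q → p ≡ q
  *-cancelˡ-≡-pos r eq =
    ≤-antisym (*-cancelˡ-≤-pos r (≤-reflexive eq)) (*-cancelˡ-≤-pos r (≤-reflexive (sym eq)))

  p≤q⇒p-q≤0 : ∀ {p q} → p ≤ q → p - q ≤ 0ℚ
  p≤q⇒p-q≤0 {p} {q} p≤q = begin
    p - q  ≤⟨ +-monoˡ-≤ (- q) p≤q ⟩
    q - q  ≡⟨ +-inverseʳ q ⟩
    0ℚ     ∎
    where open ≤-Reasoning

  p≤q⇒0≤q-p : ∀ {p q} → p ≤ q → 0ℚ ≤ q - p
  p≤q⇒0≤q-p {p} {q} p≤q = begin
    0ℚ     ≡⟨ sym (+-inverseʳ p) ⟩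
    p - p  ≤⟨ +-monoˡ-≤ (- p) p≤q ⟩
    q - p  ∎
    where open ≤-Reasoning

  p-q≤0⇒p≤q : ∀ {p q} → p - q ≤ 0ℚ → p ≤ q
  p-q≤0⇒p≤q {p} {q} p-q≤0 = begin
    p            ≡⟨ solve 2 (λ p q → p := (p :- q) :+ q) refl p q ⟩
    (p - q) + q  ≤⟨ +-monoˡ-≤ q p-q≤0 ⟩
    0ℚ + q       ≡⟨ +-identityˡ q ⟩
    q            ∎
    where open ≤-Reasoning
          open ℚ-Solver

  p≤∣p∣ : ∀ p → p ≤ ∣ p ∣
  p≤∣p∣ p with ≤-total 0ℚ p
  ... | inj₁ 0≤p = ≤-reflexive (sym (0≤p⇒∣p∣≡p 0≤p))
  ... | inj₂ p≤0 = ≤-trans p≤0 (0≤∣p∣ p)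

  ∣p-q∣≡∣q-p∣ : ∀ p q → ∣ p - q ∣ ≡ ∣ q - p ∣
  ∣p-q∣≡∣q-p∣ p q = begin
    ∣ p - q ∣      ≡⟨ sym (∣-p∣≡∣p∣ (p - q)) ⟩
    ∣ - (p - q) ∣  ≡⟨ cong ∣_∣ (solve 2 (λ p q → :- (p :- q) := q :- p) refl p q) ⟩
    ∣ q - p ∣      ∎
    where open ≡-Reasoning
          open ℚ-Solver

  ∣p-q∣≤r⇒p≤q+r : ∀ {p q r} → ∣ p - q ∣ ≤ r → p ≤ q + r
  ∣p-q∣≤r⇒p≤q+r {p} {q} {r} ∣p-q∣≤r = begin
    p            ≡⟨ solve 2 (λ p q → p := q :+ (p :- q)) refl p q ⟩
    q + (p - q)  ≤⟨ +-monoʳ-≤ q (≤-trans (p≤∣p∣ (p - q)) ∣p-q∣≤r) ⟩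
    q + r        ∎
    where open ≤-Reasoning
          open ℚ-Solver

  ∣p-q∣≤r⇒q≤p+r : ∀ {p q r} → ∣ p - q ∣ ≤ r → q ≤ p + r
  ∣p-q∣≤r⇒q≤p+r {p} {q} ∣p-q∣≤r = ∣p-q∣≤r⇒p≤q+r (subst (_≤ _) (∣p-q∣≡∣q-p∣ p q) ∣p-q∣≤r)

  ∣p+q-[r+s]∣≤∣p-r∣+∣q-s∣ : ∀ p q r s → ∣ (p + q) - (r + s) ∣ ≤ ∣ p - r ∣ + ∣ q - s ∣
  ∣p+q-[r+s]∣≤∣p-r∣+∣q-s∣ p q r s = begin
    ∣ (p + q) - (r + s) ∣      ≡⟨ cong ∣_∣ (solve 4 (λ p q r s → (p :+ q) :- (r :+ s) := (p :- r) :+ (q :- s))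
                                                  refl p q r s) ⟩
    ∣ (p - r) + (q - s) ∣      ≤⟨ ∣p+q∣≤∣p∣+∣q∣ (p - r) (q - s) ⟩
    ∣ p - r ∣ + ∣ q - s ∣      ∎
    where open ≤-Reasoning
          open ℚ-Solver

  ∣p-q-[r-s]∣≤∣p-r∣+∣q-s∣ : ∀ p q r s → ∣ (p - q) - (r - s) ∣ ≤ ∣ p - r ∣ + ∣ q - s ∣
  ∣p-q-[r-s]∣≤∣p-r∣+∣q-s∣ p q r s = begin
    ∣ (p - q) - (r - s) ∣      ≡⟨ cong ∣_∣ (solve 4 (λ p q r s → (p :- q) :- (r :- s) := (p :- r) :- (q :- s))
                                                  refl p q r s) ⟩
    ∣ (p - r) - (q - s) ∣      ≤⟨ ∣p-q∣≤∣p∣+∣q∣ (p - r) (q - s) ⟩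
    ∣ p - r ∣ + ∣ q - s ∣      ∎
    where open ≤-Reasoning
          open ℚ-Solver

  0<p⇒0<p*½ : ∀ {p} → 0ℚ < p → 0ℚ < p * ½
  0<p⇒0<p*½ 0<p = <-respˡ-≡ (*-zeroˡ ½) (*-monoˡ-<-pos ½ 0<p)

  p*½+p*½≡p : ∀ p → p * ½ + p * ½ ≡ p
  p*½+p*½≡p p = solve 1 (λ p → p :* con ½ :+ p :* con ½ := p) refl p
    where open ℚ-Solver

  p<r*½⇒r≤p+s⇒p<s : ∀ {p r s} → p < r * ½ → r ≤ p + s → p < s
  p<r*½⇒r≤p+s⇒p<s {p} {r} {s} p<r/2 r≤p+s = begin-strict
    p                  ≡⟨ solve 1 (λ p → p := (p :+ p) :- p) refl p ⟩
    (p + p) - p        <⟨ +-monoˡ-< (- p) (+-mono-< p<r/2 p<r/2) ⟩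
    (r * ½ + r * ½) - p ≡⟨ cong (_- p) (p*½+p*½≡p r) ⟩
    r - p              ≤⟨ +-monoˡ-≤ (- p) r≤p+s ⟩
    (p + s) - p        ≡⟨ solve 2 (λ p s → (p :+ s) :- p := s) refl p s ⟩
    s                  ∎
    where open ≤-Reasoning
          open ℚ-Solver

  0<p⊓q : ∀ {p q} → 0ℚ < p → 0ℚ < q → 0ℚ < p ⊓ q
  0<p⊓q {p} {q} 0<p 0<q with ⊓-sel p q
  ... | inj₁ p⊓q≡p = <-respʳ-≡ (sym p⊓q≡p) 0<p
  ... | inj₂ p⊓q≡q = <-respʳ-≡ (sym p⊓q≡q) 0<q

  -- (f ⊝ g) p unfolds to f p ⊖ g p.
  infixl 7 _⊖_
  _⊖_ : ℚ → ℚ → ℚ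
  p ⊖ q = 0ℚ ⊔ (p - q)

  0≤p⊖q : ∀ p q → 0ℚ ≤ p ⊖ q
  0≤p⊖q p q = p≤p⊔q 0ℚ (p - q)

  p≤q⇒p⊖q≡0 : ∀ {p q} → p ≤ q → p ⊖ q ≡ 0ℚ
  p≤q⇒p⊖q≡0 p≤q = p≥q⇒p⊔q≡p (p≤q⇒p-q≤0 p≤q)

  q≤p⇒p⊖q≡p-q : ∀ {p q} → q ≤ p → p ⊖ q ≡ p - q
  q≤p⇒p⊖q≡p-q q≤p = p≤q⇒p⊔q≡q (p≤q⇒0≤q-p q≤p)

  p⊖q≡0⇒p≤q : ∀ {p q} → p ⊖ q ≡ 0ℚ → p ≤ q
  p⊖q≡0⇒p≤q {p} {q} p⊖q≡0 = p-q≤0⇒p≤q (begin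
    p - q  ≤⟨ p≤q⊔p 0ℚ (p - q) ⟩
    p ⊖ q  ≡⟨ p⊖q≡0 ⟩
    0ℚ     ∎)
    where open ≤-Reasoning

  p+[q⊖p]≡p⊔q : ∀ p q → p + (q ⊖ p) ≡ p ⊔ q
  p+[q⊖p]≡p⊔q p q with ≤-total p q
  ... | inj₁ p≤q = begin
    p + (q ⊖ p)  ≡⟨ cong (_+_ p) (q≤p⇒p⊖q≡p-q p≤q) ⟩
    p + (q - p)  ≡⟨ solve 2 (λ p q → p :+ (q :- p) := q) refl p q ⟩
    q            ≡⟨ sym (p≤q⇒p⊔q≡q p≤q) ⟩
    p ⊔ q        ∎
    where open ≡-Reasoning
          open ℚ-Solver
  ... | inj₂ q≤p = begin
    p + (q ⊖ p)  ≡⟨ cong (_+_ p) (p≤q⇒p⊖q≡0 q≤p) ⟩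
    p + 0ℚ       ≡⟨ +-identityʳ p ⟩
    p            ≡⟨ sym (p≥q⇒p⊔q≡p q≤p) ⟩
    p ⊔ q        ∎
    where open ≡-Reasoning

  ∣p-q∣≡p⊖q+q⊖p : ∀ p q → ∣ p - q ∣ ≡ p ⊖ q + q ⊖ p
  ∣p-q∣≡p⊖q+q⊖p p q with ≤-total p q
  ... | inj₁ p≤q = begin
    ∣ p - q ∣        ≡⟨ ∣p-q∣≡∣q-p∣ p q ⟩
    ∣ q - p ∣        ≡⟨ 0≤p⇒∣p∣≡p (p≤q⇒0≤q-p p≤q) ⟩
    q - p            ≡⟨ sym (+-identityˡ (q - p)) ⟩
    0ℚ + (q - p)     ≡⟨ cong (_+ (q - p)) (sym (p≤q⇒p⊖q≡0 p≤q)) ⟩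
    p ⊖ q + (q - p)  ≡⟨ cong (_+_ (p ⊖ q)) (sym (q≤p⇒p⊖q≡p-q p≤q)) ⟩
    p ⊖ q + q ⊖ p    ∎
    where open ≡-Reasoning
  ... | inj₂ q≤p = begin
    ∣ p - q ∣        ≡⟨ 0≤p⇒∣p∣≡p (p≤q⇒0≤q-p q≤p) ⟩
    p - q            ≡⟨ sym (+-identityʳ (p - q)) ⟩
    (p - q) + 0ℚ     ≡⟨ cong (_+_ (p - q)) (sym (p≤q⇒p⊖q≡0 q≤p)) ⟩
    (p - q) + q ⊖ p  ≡⟨ cong (_+ (q ⊖ p)) (sym (q≤p⇒p⊖q≡p-q q≤p)) ⟩
    p ⊖ q + q ⊖ p    ∎
    where open ≡-Reasoning

  p≤∣p-q∣ : ∀ {p q} → 0ℚ ≤ p → q ≤ 0ℚ → p ≤ ∣ p - q ∣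
  p≤∣p-q∣ {p} {q} 0≤p q≤0 = begin
    p          ≡⟨ sym (+-identityʳ p) ⟩
    p + 0ℚ     ≤⟨ +-monoʳ-≤ p (neg-antimono-≤ q≤0) ⟩
    p - q      ≤⟨ p≤∣p∣ (p - q) ⟩
    ∣ p - q ∣  ∎
    where open ≤-Reasoning

  ∣0⊔p-0⊔q∣≤∣p-q∣ : ∀ p q → ∣ (0ℚ ⊔ p) - (0ℚ ⊔ q) ∣ ≤ ∣ p - q ∣
  ∣0⊔p-0⊔q∣≤∣p-q∣ p q with ≤-total 0ℚ p | ≤-total 0ℚ q
  ... | inj₁ 0≤p | inj₁ 0≤q rewrite p≤q⇒p⊔q≡q 0≤p | p≤q⇒p⊔q≡q 0≤q = ≤-refl
  ... | inj₂ p≤0 | inj₂ q≤0 rewrite p≥q⇒p⊔q≡p p≤0 | p≥q⇒p⊔q≡p q≤0 = 0≤∣p∣ (p - q)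
  ... | inj₁ 0≤p | inj₂ q≤0 rewrite p≤q⇒p⊔q≡q 0≤p | p≥q⇒p⊔q≡p q≤0 = begin
    ∣ p - 0ℚ ∣  ≡⟨ cong ∣_∣ (+-identityʳ p) ⟩
    ∣ p ∣       ≡⟨ 0≤p⇒∣p∣≡p 0≤p ⟩
    p           ≤⟨ p≤∣p-q∣ 0≤p q≤0 ⟩
    ∣ p - q ∣   ∎
    where open ≤-Reasoning
  ... | inj₂ p≤0 | inj₁ 0≤q rewrite p≥q⇒p⊔q≡p p≤0 | p≤q⇒p⊔q≡q 0≤q = begin
    ∣ 0ℚ - q ∣  ≡⟨ cong ∣_∣ (+-identityˡ (- q)) ⟩
    ∣ - q ∣     ≡⟨ ∣-p∣≡∣p∣ q ⟩
    ∣ q ∣       ≡⟨ 0≤p⇒∣p∣≡p 0≤q ⟩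
    q           ≤⟨ p≤∣p-q∣ 0≤q p≤0 ⟩
    ∣ q - p ∣   ≡⟨ ∣p-q∣≡∣q-p∣ q p ⟩
    ∣ p - q ∣   ∎
    where open ≤-Reasoning

  ∣p⊖q-r⊖s∣≤∣p-r∣+∣q-s∣ : ∀ p q r s → ∣ p ⊖ q - r ⊖ s ∣ ≤ ∣ p - r ∣ + ∣ q - s ∣
  ∣p⊖q-r⊖s∣≤∣p-r∣+∣q-s∣ p q r s =
    ≤-trans (∣0⊔p-0⊔q∣≤∣p-q∣ (p - q) (r - s)) (∣p-q-[r-s]∣≤∣p-r∣+∣q-s∣ p q r s)

  Σℚ-cong : ∀ {d} {u v : Fin d → ℚ} → (∀ i → u i ≡ v i) → Σℚ u ≡ Σℚ v
  Σℚ-cong {zero}  u≗v = refl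
  Σℚ-cong {suc d} u≗v = cong₂ _+_ (u≗v fzero) (Σℚ-cong (λ i → u≗v (fsuc i)))

  Σℚ-zero : ∀ {d} {u : Fin d → ℚ} → (∀ i → u i ≡ 0ℚ) → Σℚ u ≡ 0ℚ
  Σℚ-zero {zero}  u≗0 = refl
  Σℚ-zero {suc d} u≗0 = cong₂ _+_ (u≗0 fzero) (Σℚ-zero (λ i → u≗0 (fsuc i)))

  Σℚ-distrib-+ : ∀ {d} (u v : Fin d → ℚ) → Σℚ (λ i → u i + v i) ≡ Σℚ u + Σℚ v
  Σℚ-distrib-+ {zero}  u v = refl
  Σℚ-distrib-+ {suc d} u v = begin
    (u₀ + v₀) + Σℚ (λ i → u′ i + v′ i)  ≡⟨ cong (_+_ (u₀ + v₀)) (Σℚ-distrib-+ u′ v′) ⟩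
    (u₀ + v₀) + (Σℚ u′ + Σℚ v′)         ≡⟨ solve 4 (λ a b c e → (a :+ b) :+ (c :+ e) := (a :+ c) :+ (b :+ e))
                                               refl u₀ v₀ (Σℚ u′) (Σℚ v′) ⟩
    (u₀ + Σℚ u′) + (v₀ + Σℚ v′)         ∎
    where open ≡-Reasoning
          open ℚ-Solver
          u₀ = u fzero
          v₀ = v fzero
          u′ = λ i → u (fsuc i)
          v′ = λ i → v (fsuc i)

  Σℚ-neg : ∀ {d} (u : Fin d → ℚ) → Σℚ (λ i → - u i) ≡ - Σℚ u
  Σℚ-neg {zero}  u = refl
  Σℚ-neg {suc d} u = begin
    - u fzero + Σℚ (λ i → - u (fsuc i))  ≡⟨ cong (_+_ (- u fzero)) (Σℚ-neg (λ i → u (fsuc i))) ⟩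
    - u fzero + - Σℚ (λ i → u (fsuc i))  ≡⟨ sym (neg-distrib-+ (u fzero) _) ⟩
    - Σℚ u                               ∎
    where open ≡-Reasoning

  Σℚ-distrib-- : ∀ {d} (u v : Fin d → ℚ) → Σℚ (λ i → u i - v i) ≡ Σℚ u - Σℚ v
  Σℚ-distrib-- u v = trans (Σℚ-distrib-+ u (λ i → - v i)) (cong (_+_ (Σℚ u)) (Σℚ-neg v))

  *-distribˡ-Σℚ : ∀ {d} c (u : Fin d → ℚ) → c * Σℚ u ≡ Σℚ (λ i → c * u i)
  *-distribˡ-Σℚ {zero}  c u = *-zeroʳ c
  *-distribˡ-Σℚ {suc d} c u =
    trans (*-distribˡ-+ c (u fzero) _) (cong (_+_ (c * u fzero)) (*-distribˡ-Σℚ c (λ i → u (fsuc i))))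

  Σℚ-mono-≤ : ∀ {d} {u v : Fin d → ℚ} → (∀ i → u i ≤ v i) → Σℚ u ≤ Σℚ v
  Σℚ-mono-≤ {zero}  u≤v = ≤-refl
  Σℚ-mono-≤ {suc d} u≤v = +-mono-≤ (u≤v fzero) (Σℚ-mono-≤ (λ i → u≤v (fsuc i)))

  Σℚ-nonNeg : ∀ {d} {u : Fin d → ℚ} → (∀ i → 0ℚ ≤ u i) → 0ℚ ≤ Σℚ u
  Σℚ-nonNeg {zero}  0≤u = ≤-refl
  Σℚ-nonNeg {suc d} 0≤u = +-mono-≤ (0≤u fzero) (Σℚ-nonNeg (λ i → 0≤u (fsuc i)))

  Σℚ-term : ∀ {d} {u : Fin d → ℚ} → (∀ i → 0ℚ ≤ u i) → ∀ i → u i ≤ Σℚ u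
  Σℚ-term {suc d} {u} 0≤u fzero = begin
    u fzero       ≡⟨ sym (+-identityʳ (u fzero)) ⟩
    u fzero + 0ℚ  ≤⟨ +-monoʳ-≤ (u fzero) (Σℚ-nonNeg (λ i → 0≤u (fsuc i))) ⟩
    Σℚ u          ∎
    where open ≤-Reasoning
  Σℚ-term {suc d} {u} 0≤u (fsuc i) = begin
    u (fsuc i)                     ≤⟨ Σℚ-term (λ j → 0≤u (fsuc j)) i ⟩
    Σℚ (λ j → u (fsuc j))          ≡⟨ sym (+-identityˡ _) ⟩
    0ℚ + Σℚ (λ j → u (fsuc j))     ≤⟨ +-monoˡ-≤ _ (0≤u fzero) ⟩
    Σℚ u                           ∎
    where open ≤-Reasoning

  ∣Σℚ∣≤Σℚ∣∣ : ∀ {d} (u : Fin d → ℚ) → ∣ Σℚ u ∣ ≤ Σℚ (λ i → ∣ u i ∣)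
  ∣Σℚ∣≤Σℚ∣∣ {zero}  u = ≤-refl
  ∣Σℚ∣≤Σℚ∣∣ {suc d} u =
    ≤-trans (∣p+q∣≤∣p∣+∣q∣ (u fzero) _) (+-monoʳ-≤ ∣ u fzero ∣ (∣Σℚ∣≤Σℚ∣∣ (λ i → u (fsuc i))))

  ⋁ℚ-lub : ∀ {d} {u : Fin d → ℚ} {c} → 0ℚ ≤ c → (∀ i → u i ≤ c) → ⋁ℚ u ≤ c
  ⋁ℚ-lub {zero}  0≤c u≤c = 0≤c
  ⋁ℚ-lub {suc d} 0≤c u≤c = ⊔-lub (u≤c fzero) (⋁ℚ-lub 0≤c (λ i → u≤c (fsuc i)))

  dist : ∀ {d} → Point d → Point d → ℚ
  dist x y = Σℚ (λ i → ∣ x i - y i ∣)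

  dist-nonNeg : ∀ {d} (x y : Point d) → 0ℚ ≤ dist x y
  dist-nonNeg x y = Σℚ-nonNeg (λ i → 0≤∣p∣ (x i - y i))

  ∣xᵢ-yᵢ∣≤dist : ∀ {d} (x y : Point d) i → ∣ x i - y i ∣ ≤ dist x y
  ∣xᵢ-yᵢ∣≤dist x y = Σℚ-term (λ i → 0≤∣p∣ (x i - y i))

  δ : ∀ {d} → Fin d → Fin d → ℤ
  δ fzero    fzero    = + 1
  δ fzero    (fsuc _) = + 0
  δ (fsuc _) fzero    = + 0
  δ (fsuc i) (fsuc j) = δ i j

  Σℚ-δ : ∀ {d} (i : Fin d) (p : Point d) → Σℚ (λ j → ι (δ i j) * p j) ≡ p i
  Σℚ-δ {suc d} fzero p = begin
    1ℚ * p fzero + Σℚ (λ j → 0ℚ * p (fsuc j))  ≡⟨ cong₂ _+_ (*-identityˡ (p fzero))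
                                                              (Σℚ-zero (λ j → *-zeroˡ (p (fsuc j)))) ⟩
    p fzero + 0ℚ                                ≡⟨ +-identityʳ (p fzero) ⟩
    p fzero                                     ∎
    where open ≡-Reasoning
  Σℚ-δ {suc d} (fsuc i) p = begin
    0ℚ * p fzero + Σℚ (λ j → ι (δ i j) * p (fsuc j))  ≡⟨ cong₂ _+_ (*-zeroˡ (p fzero)) (Σℚ-δ i (λ j → p (fsuc j))) ⟩
    0ℚ + p (fsuc i)                                   ≡⟨ +-identityˡ (p (fsuc i)) ⟩
    p (fsuc i)                                        ∎
    where open ≡-Reasoning

  module _ {d : ℕ} where

    constᴬ : ℤ → Affine d
    constᴬ b = affine (λ _ → + 0) b

    coordᴬ : Fin d → Affine d
    coordᴬ i = affine (δ i) (+ 0)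

    _+ᴬ_ : Affine d → Affine d → Affine d
    affine c b +ᴬ affine c′ b′ = affine (λ i → c i ℤ.+ c′ i) (b ℤ.+ b′)

    -ᴬ_ : Affine d → Affine d
    -ᴬ affine c b = affine (λ i → ℤ.- c i) (ℤ.- b)

    ‖_‖ : Affine d → ℚ
    ‖ affine c _ ‖ = Σℚ (λ i → ∣ ι (c i) ∣)

    linear : (Fin d → ℤ) → Point d → ℚ
    linear c p = Σℚ (λ i → ι (c i) * p i)

    linear-+ : ∀ c c′ p → linear (λ i → c i ℤ.+ c′ i) p ≡ linear c p + linear c′ p
    linear-+ c c′ p = begin
      Σℚ (λ i → ι (c i ℤ.+ c′ i) * p i)          ≡⟨ Σℚ-cong (λ i → cong (_* p i) (ι-+ (c i) (c′ i))) ⟩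
      Σℚ (λ i → (ι (c i) + ι (c′ i)) * p i)      ≡⟨ Σℚ-cong (λ i → *-distribʳ-+ (p i) (ι (c i)) (ι (c′ i))) ⟩
      Σℚ (λ i → ι (c i) * p i + ι (c′ i) * p i)  ≡⟨ Σℚ-distrib-+ (λ i → ι (c i) * p i) (λ i → ι (c′ i) * p i) ⟩
      linear c p + linear c′ p                   ∎
      where open ≡-Reasoning

    linear-neg : ∀ c p → linear (λ i → ℤ.- c i) p ≡ - linear c p
    linear-neg c p = begin
      Σℚ (λ i → ι (ℤ.- c i) * p i)    ≡⟨ Σℚ-cong (λ i → cong (_* p i) (ι-neg (c i))) ⟩
      Σℚ (λ i → (- ι (c i)) * p i)    ≡⟨ Σℚ-cong (λ i → sym (neg-distribˡ-* (ι (c i)) (p i))) ⟩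
      Σℚ (λ i → - (ι (c i) * p i))    ≡⟨ Σℚ-neg (λ i → ι (c i) * p i) ⟩
      - linear c p                    ∎
      where open ≡-Reasoning

    eval-constᴬ : ∀ b p → evalAffine (constᴬ b) p ≡ ι b
    eval-constᴬ b p = trans (cong (_+ ι b) (Σℚ-zero (λ i → *-zeroˡ (p i)))) (+-identityˡ (ι b))

    eval-coordᴬ : ∀ i p → evalAffine (coordᴬ i) p ≡ p i
    eval-coordᴬ i p = trans (cong (_+ 0ℚ) (Σℚ-δ i p)) (+-identityʳ (p i))

    eval-+ᴬ : ∀ a a′ p → evalAffine (a +ᴬ a′) p ≡ evalAffine a p + evalAffine a′ p
    eval-+ᴬ (affine c b) (affine c′ b′) p = begin
      linear (λ i → c i ℤ.+ c′ i) p + ι (b ℤ.+ b′)  ≡⟨ cong₂ _+_ (linear-+ c c′ p) (ι-+ b b′) ⟩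
      (l + l′) + (ι b + ι b′)                       ≡⟨ solve 4 (λ l l′ e e′ → (l :+ l′) :+ (e :+ e′) := (l :+ e) :+ (l′ :+ e′))
                                                         refl l l′ (ι b) (ι b′) ⟩
      (l + ι b) + (l′ + ι b′)                       ∎
      where open ≡-Reasoning
            open ℚ-Solver
            l  = linear c p
            l′ = linear c′ p

    eval--ᴬ : ∀ a p → evalAffine (-ᴬ a) p ≡ - evalAffine a p
    eval--ᴬ (affine c b) p = begin
      linear (λ i → ℤ.- c i) p + ι (ℤ.- b)  ≡⟨ cong₂ _+_ (linear-neg c p) (ι-neg b) ⟩
      - linear c p + - ι b                  ≡⟨ sym (neg-distrib-+ (linear c p) (ι b)) ⟩
      - (linear c p + ι b)                  ∎
      where open ≡-Reasoning

    eval-difference : ∀ a x y → evalAffine a x - evalAffine a y ≡ Σℚ (λ i → ι (Affine.coeff a i) * (x i - y i))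
    eval-difference (affine c b) x y = begin
      (linear c x + ι b) - (linear c y + ι b)   ≡⟨ solve 3 (λ u v e → (u :+ e) :- (v :+ e) := u :- v)
                                                     refl (linear c x) (linear c y) (ι b) ⟩
      linear c x - linear c y                   ≡⟨ sym (Σℚ-distrib-- (λ i → ι (c i) * x i) (λ i → ι (c i) * y i)) ⟩
      Σℚ (λ i → ι (c i) * x i - ι (c i) * y i)  ≡⟨ Σℚ-cong (λ i → solve 3 (λ c u v → c :* u :- c :* v := c :* (u :- v))
                                                                     refl (ι (c i)) (x i) (y i)) ⟩
      Σℚ (λ i → ι (c i) * (x i - y i))          ∎
      where open ≡-Reasoning
            open ℚ-Solver

    affine-lipschitz : ∀ a x y → ∣ evalAffine a x - evalAffine a y ∣ ≤ ‖ a ‖ * dist x y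
    affine-lipschitz a@(affine c b) x y = begin
      ∣ evalAffine a x - evalAffine a y ∣    ≡⟨ cong ∣_∣ (eval-difference a x y) ⟩
      ∣ Σℚ (λ i → ι (c i) * (x i - y i)) ∣   ≤⟨ ∣Σℚ∣≤Σℚ∣∣ (λ i → ι (c i) * (x i - y i)) ⟩
      Σℚ (λ i → ∣ ι (c i) * (x i - y i) ∣)   ≤⟨ Σℚ-mono-≤ term≤norm*dist ⟩
      Σℚ (λ i → ‖ a ‖ * ∣ x i - y i ∣)       ≡⟨ sym (*-distribˡ-Σℚ ‖ a ‖ (λ i → ∣ x i - y i ∣)) ⟩
      ‖ a ‖ * dist x y                       ∎
      where
      open ≤-Reasoning
      term≤norm*dist : ∀ i → ∣ ι (c i) * (x i - y i) ∣ ≤ ‖ a ‖ * ∣ x i - y i ∣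
      term≤norm*dist i = begin
        ∣ ι (c i) * (x i - y i) ∣    ≡⟨ ∣p*q∣≡∣p∣*∣q∣ (ι (c i)) (x i - y i) ⟩
        ∣ ι (c i) ∣ * ∣ x i - y i ∣  ≤⟨ *-monoʳ-≤-nonNeg ∣ x i - y i ∣ {{∣-∣-nonNeg (x i - y i)}}
                                         (Σℚ-term (λ j → 0≤∣p∣ (ι (c j))) i) ⟩
        ‖ a ‖ * ∣ x i - y i ∣        ∎

    affine-upper : ∀ a x y → evalAffine a x ≤ evalAffine a y + ‖ a ‖ * dist x y
    affine-upper a x y = ∣p-q∣≤r⇒p≤q+r {evalAffine a x} {evalAffine a y} (affine-lipschitz a x y)

    affine-lower : ∀ a x y → evalAffine a y ≤ evalAffine a x + ‖ a ‖ * dist x y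
    affine-lower a x y = ∣p-q∣≤r⇒q≤p+r {evalAffine a x} {evalAffine a y} (affine-lipschitz a x y)

  module _ {d : ℕ} where

    PIL-affine : ∀ {f : Fun d} a → (∀ p → InCube p → f p ≡ evalAffine a p) → PiecewiseIntegerLinear f
    PIL-affine a f≡a = a ∷ [] , λ p p∈cube → a , here refl , f≡a p p∈cube

    PIL-⊕ : ∀ {f g : Fun d} → PiecewiseIntegerLinear f → PiecewiseIntegerLinear g →
            PiecewiseIntegerLinear (f ⊕ g)
    PIL-⊕ {f} {g} (as , f-on-as) (bs , g-on-bs) = cartesianProductWith _+ᴬ_ as bs , piece
      where
      piece : ∀ p → InCube p → ∃[ c ] (c ∈ cartesianProductWith _+ᴬ_ as bs × (f ⊕ g) p ≡ evalAffine c p)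
      piece p p∈cube with f-on-as p p∈cube | g-on-bs p p∈cube
      ... | a , a∈as , fp≡ap | b , b∈bs , gp≡bp =
        a +ᴬ b , ∈-cartesianProductWith⁺ _+ᴬ_ a∈as b∈bs , trans (cong₂ _+_ fp≡ap gp≡bp) (sym (eval-+ᴬ a b p))

    PIL-⊝ : ∀ {f g : Fun d} → PiecewiseIntegerLinear f → PiecewiseIntegerLinear g →
            PiecewiseIntegerLinear (f ⊝ g)
    PIL-⊝ {f} {g} (as , f-on-as) (bs , g-on-bs) = pieces , piece
      where
      _-ᴬ_ : Affine d → Affine d → Affine d
      a -ᴬ b = a +ᴬ (-ᴬ b)
      pieces : List (Affine d)
      pieces = constᴬ (+ 0) ∷ cartesianProductWith _-ᴬ_ as bs
      piece : ∀ p → InCube p → ∃[ c ] (c ∈ pieces × (f ⊝ g) p ≡ evalAffine c p)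
      piece p p∈cube with f p ≤? g p | f-on-as p p∈cube | g-on-bs p p∈cube
      ... | yes fp≤gp | _ | _ = constᴬ (+ 0) , here refl , trans (p≤q⇒p⊖q≡0 fp≤gp) (sym (eval-constᴬ (+ 0) p))
      ... | no fp≰gp | a , a∈as , fp≡ap | b , b∈bs , gp≡bp =
        a -ᴬ b , there (∈-cartesianProductWith⁺ _-ᴬ_ a∈as b∈bs) , (begin
          f p ⊖ g p                             ≡⟨ q≤p⇒p⊖q≡p-q (<⇒≤ (≰⇒> fp≰gp)) ⟩
          f p - g p                             ≡⟨ cong₂ _-_ fp≡ap gp≡bp ⟩
          evalAffine a p - evalAffine b p       ≡⟨ cong (_+_ (evalAffine a p)) (sym (eval--ᴬ b p)) ⟩
          evalAffine a p + evalAffine (-ᴬ b) p  ≡⟨ sym (eval-+ᴬ a (-ᴬ b) p) ⟩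
          evalAffine (a -ᴬ b) p                 ∎)
        where open ≡-Reasoning

    UC-const : ∀ c → UniformlyContinuous {d} (λ _ → c)
    UC-const c ε 0<ε = ε , 0<ε , λ _ _ _ _ _ → <-respˡ-≡ (sym (cong ∣_∣ (+-inverseʳ c))) 0<ε

    UC-coord : ∀ i → UniformlyContinuous (xᵢ {d} i)
    UC-coord i ε 0<ε = ε , 0<ε , λ _ _ _ _ close → close i

    UC-combine : ∀ {f g h : Fun d} → (∀ x y → ∣ h x - h y ∣ ≤ ∣ f x - f y ∣ + ∣ g x - g y ∣) →
                 UniformlyContinuous f → UniformlyContinuous g → UniformlyContinuous h
    UC-combine {f} {g} {h} h-bound uc-f uc-g ε 0<ε
      with uc-f (ε * ½) (0<p⇒0<p*½ 0<ε) | uc-g (ε * ½) (0<p⇒0<p*½ 0<ε)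
    ... | δ₁ , 0<δ₁ , close-f | δ₂ , 0<δ₂ , close-g = δ₁ ⊓ δ₂ , 0<p⊓q 0<δ₁ 0<δ₂ , close
      where
      close : ∀ x y → InCube x → InCube y → (∀ i → ∣ x i - y i ∣ < δ₁ ⊓ δ₂) → ∣ h x - h y ∣ < ε
      close x y x∈cube y∈cube x≈y = begin-strict
        ∣ h x - h y ∣                  ≤⟨ h-bound x y ⟩
        ∣ f x - f y ∣ + ∣ g x - g y ∣  <⟨ +-mono-< (close-f x y x∈cube y∈cube (λ i → <-≤-trans (x≈y i) (p⊓q≤p δ₁ δ₂)))
                                                  (close-g x y x∈cube y∈cube (λ i → <-≤-trans (x≈y i) (p⊓q≤q δ₁ δ₂))) ⟩
        ε * ½ + ε * ½                  ≡⟨ p*½+p*½≡p ε ⟩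
        ε                              ∎
        where open ≤-Reasoning

    InG⁺-𝟎 : InG⁺ {d} 𝟎
    InG⁺-𝟎 = (PIL-affine (constᴬ (+ 0)) (λ p _ → sym (eval-constᴬ (+ 0) p)) , UC-const 0ℚ) , λ _ _ → ≤-refl

    InG⁺-𝟏 : InG⁺ {d} 𝟏
    InG⁺-𝟏 = (PIL-affine (constᴬ (+ 1)) (λ p _ → sym (eval-constᴬ (+ 1) p)) , UC-const 1ℚ) ,
             λ _ _ → nonNegative⁻¹ 1ℚ

    InG⁺-xᵢ : ∀ i → InG⁺ (xᵢ {d} i)
    InG⁺-xᵢ i = (PIL-affine (coordᴬ i) (λ p _ → sym (eval-coordᴬ i p)) , UC-coord i) ,
                λ p p∈cube → proj₁ (p∈cube i)

    InG⁺-⊕ : ∀ {f g : Fun d} → InG⁺ f → InG⁺ g → InG⁺ (f ⊕ g)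
    InG⁺-⊕ {f} {g} ((pil-f , uc-f) , 0≤f) ((pil-g , uc-g) , 0≤g) =
      (PIL-⊕ pil-f pil-g ,
       UC-combine {f} {g} {f ⊕ g} (λ x y → ∣p+q-[r+s]∣≤∣p-r∣+∣q-s∣ (f x) (g x) (f y) (g y)) uc-f uc-g) ,
      λ p p∈cube → +-mono-≤ (0≤f p p∈cube) (0≤g p p∈cube)

    InG⁺-⊝ : ∀ {f g : Fun d} → InG⁺ f → InG⁺ g → InG⁺ (f ⊝ g)
    InG⁺-⊝ {f} {g} ((pil-f , uc-f) , _) ((pil-g , uc-g) , _) =
      (PIL-⊝ pil-f pil-g ,
       UC-combine {f} {g} {f ⊝ g} (λ x y → ∣p⊖q-r⊖s∣≤∣p-r∣+∣q-s∣ (f x) (g x) (f y) (g y)) uc-f uc-g) ,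
      λ p _ → 0≤p⊖q (f p) (g p)

    InG⁺-resp-≈ : ∀ {f g : Fun d} → f ≈ g → InG⁺ f → InG⁺ g
    InG⁺-resp-≈ {f} {g} f≈g (((pieces , f-on-pieces) , uc-f) , 0≤f) =
      ((pieces , g-on-pieces) , uc-g) , λ p p∈cube → subst (0ℚ ≤_) (f≈g p p∈cube) (0≤f p p∈cube)
      where
      g-on-pieces : ∀ p → InCube p → ∃[ a ] (a ∈ pieces × g p ≡ evalAffine a p)
      g-on-pieces p p∈cube with f-on-pieces p p∈cube
      ... | a , a∈pieces , fp≡ap = a , a∈pieces , trans (sym (f≈g p p∈cube)) fp≡ap
      uc-g : UniformlyContinuous g
      uc-g ε 0<ε with uc-f ε 0<ε
      ... | δ , 0<δ , close = δ , 0<δ , λ x y x∈cube y∈cube x≈y →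
        subst (_< ε) (cong₂ (λ u v → ∣ u - v ∣) (f≈g x x∈cube) (f≈g y y∈cube))
                     (close x y x∈cube y∈cube x≈y)

  module _ {d : ℕ} where

    _⊛_ : ℕ → Fun d → Fun d
    zero  ⊛ f = 𝟎
    suc k ⊛ f = f ⊕ (k ⊛ f)

    Σᶠ : ∀ {m} → (Fin m → Fun d) → Fun d
    Σᶠ {zero}  F = 𝟎
    Σᶠ {suc m} F = F fzero ⊕ Σᶠ (λ i → F (fsuc i))

    _∨ᶠ_ : Fun d → Fun d → Fun d
    f ∨ᶠ g = f ⊕ (g ⊝ f)

    ⋁ᶠ : ∀ {m} → (Fin m → Fun d) → Fun d
    ⋁ᶠ {zero}  F = 𝟎
    ⋁ᶠ {suc m} F = F fzero ∨ᶠ ⋁ᶠ (λ i → F (fsuc i))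

    _△_ : Fun d → Fun d → Fun d
    f △ g = (f ⊝ g) ⊕ (g ⊝ f)

    ⊛-pointwise : ∀ k f x → (k ⊛ f) x ≡ ιℕ k * f x
    ⊛-pointwise zero    f x = sym (*-zeroˡ (f x))
    ⊛-pointwise (suc k) f x = trans (cong (_+_ (f x)) (⊛-pointwise k f x)) (p+ιℕk*p≡ιℕ[1+k]*p k (f x))

    Σᶠ-pointwise : ∀ {m} (F : Fin m → Fun d) x → Σᶠ F x ≡ Σℚ (λ i → F i x)
    Σᶠ-pointwise {zero}  F x = refl
    Σᶠ-pointwise {suc m} F x = cong (_+_ (F fzero x)) (Σᶠ-pointwise (λ i → F (fsuc i)) x)

    ⋁ᶠ-pointwise : ∀ {m} (F : Fin m → Fun d) x → ⋁ᶠ F x ≡ ⋁ℚ (λ i → F i x)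
    ⋁ᶠ-pointwise {zero}  F x = refl
    ⋁ᶠ-pointwise {suc m} F x =
      trans (cong (λ v → F fzero x + v ⊖ F fzero x) (⋁ᶠ-pointwise (λ i → F (fsuc i)) x))
            (p+[q⊖p]≡p⊔q (F fzero x) (⋁ℚ (λ i → F (fsuc i) x)))

    △-pointwise : ∀ f g x → (f △ g) x ≡ ∣ f x - g x ∣
    △-pointwise f g x = sym (∣p-q∣≡p⊖q+q⊖p (f x) (g x))

    InG⁺-⊛ : ∀ k {f} → InG⁺ f → InG⁺ (k ⊛ f)
    InG⁺-⊛ zero    f∈G⁺ = InG⁺-𝟎
    InG⁺-⊛ (suc k) f∈G⁺ = InG⁺-⊕ f∈G⁺ (InG⁺-⊛ k f∈G⁺)

    InG⁺-Σᶠ : ∀ {m} {F : Fin m → Fun d} → (∀ i → InG⁺ (F i)) → InG⁺ (Σᶠ F)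
    InG⁺-Σᶠ {zero}  F∈G⁺ = InG⁺-𝟎
    InG⁺-Σᶠ {suc m} F∈G⁺ = InG⁺-⊕ (F∈G⁺ fzero) (InG⁺-Σᶠ (λ i → F∈G⁺ (fsuc i)))

    InG⁺-∨ᶠ : ∀ {f g} → InG⁺ f → InG⁺ g → InG⁺ (f ∨ᶠ g)
    InG⁺-∨ᶠ f∈G⁺ g∈G⁺ = InG⁺-⊕ f∈G⁺ (InG⁺-⊝ g∈G⁺ f∈G⁺)

    InG⁺-⋁ᶠ : ∀ {m} {F : Fin m → Fun d} → (∀ i → InG⁺ (F i)) → InG⁺ (⋁ᶠ F)
    InG⁺-⋁ᶠ {zero}  F∈G⁺ = InG⁺-𝟎
    InG⁺-⋁ᶠ {suc m} F∈G⁺ = InG⁺-∨ᶠ (F∈G⁺ fzero) (InG⁺-⋁ᶠ (λ i → F∈G⁺ (fsuc i)))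

    InG⁺-△ : ∀ {f g} → InG⁺ f → InG⁺ g → InG⁺ (f △ g)
    InG⁺-△ f∈G⁺ g∈G⁺ = InG⁺-⊕ (InG⁺-⊝ f∈G⁺ g∈G⁺) (InG⁺-⊝ g∈G⁺ f∈G⁺)

    𝟏⊝⋁xᵢ≈xₙ : (𝟏 ⊝ ⋁ᶠ xᵢ) ≈ xₙ {d}
    𝟏⊝⋁xᵢ≈xₙ x x∈cube = begin
      1ℚ ⊖ ⋁ᶠ xᵢ x  ≡⟨ cong (1ℚ ⊖_) (⋁ᶠ-pointwise xᵢ x) ⟩
      1ℚ ⊖ ⋁ℚ x     ≡⟨ q≤p⇒p⊖q≡p-q (⋁ℚ-lub (nonNegative⁻¹ 1ℚ) (λ i → proj₂ (x∈cube i))) ⟩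
      1ℚ - ⋁ℚ x     ∎
      where open ≡-Reasoning

    InG⁺-xₙ : InG⁺ (xₙ {d})
    InG⁺-xₙ = InG⁺-resp-≈ 𝟏⊝⋁xᵢ≈xₙ (InG⁺-⊝ InG⁺-𝟏 (InG⁺-⋁ᶠ InG⁺-xᵢ))

    𝟏≈xₙ⊕⋁xᵢ : 𝟏 ≈ (xₙ {d} ⊕ ⋁ᶠ xᵢ)
    𝟏≈xₙ⊕⋁xᵢ x _ = begin
      1ℚ                         ≡⟨ solve 2 (λ a b → a := (a :- b) :+ b) refl 1ℚ (⋁ℚ x) ⟩
      (1ℚ - ⋁ℚ x) + ⋁ℚ x         ≡⟨ cong (_+_ (1ℚ - ⋁ℚ x)) (sym (⋁ᶠ-pointwise xᵢ x)) ⟩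
      (1ℚ - ⋁ℚ x) + ⋁ᶠ xᵢ x      ∎
      where open ≡-Reasoning
            open ℚ-Solver

  record IsHoopHom {d} (φ : Fun d → ℚ) : Set where
    field
      resp-≈ : ∀ {f g} → InG⁺ f → InG⁺ g → f ≈ g → φ f ≡ φ g
      pres-+ : ∀ {f g} → InG⁺ f → InG⁺ g → φ (f ⊕ g) ≡ φ f + φ g
      pres-∸ : ∀ {f g} → InG⁺ f → InG⁺ g → φ (f ⊝ g) ≡ φ f ⊖ φ g

  endo-at-point : ∀ {d} {σ : Fun d → Fun d} → IsHoopEndo σ → ∀ {p} → InCube p →
                  IsHoopHom (λ f → σ f p)
  endo-at-point endo {p} p∈cube = record
    { resp-≈ = λ {f} {g} f∈G⁺ g∈G⁺ f≈g → IsHoopEndo.cong endo f g f∈G⁺ g∈G⁺ f≈g p p∈cube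
    ; pres-+ = λ {f} {g} f∈G⁺ g∈G⁺ → IsHoopEndo.pres-+ endo f g f∈G⁺ g∈G⁺ p p∈cube
    ; pres-∸ = λ {f} {g} f∈G⁺ g∈G⁺ → IsHoopEndo.pres-∸ endo f g f∈G⁺ g∈G⁺ p p∈cube
    }

  module HoopHom {d} {φ : Fun d → ℚ} (hom : IsHoopHom φ) where
    open IsHoopHom hom

    φ-𝟎 : φ 𝟎 ≡ 0ℚ
    φ-𝟎 = begin
      φ 𝟎          ≡⟨ resp-≈ InG⁺-𝟎 (InG⁺-⊝ InG⁺-𝟎 InG⁺-𝟎) (λ _ _ → refl) ⟩
      φ (𝟎 ⊝ 𝟎)    ≡⟨ pres-∸ InG⁺-𝟎 InG⁺-𝟎 ⟩
      φ 𝟎 ⊖ φ 𝟎    ≡⟨ p≤q⇒p⊖q≡0 (≤-refl {φ 𝟎}) ⟩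
      0ℚ           ∎
      where open ≡-Reasoning

    φ-nonNeg : ∀ {f} → InG⁺ f → 0ℚ ≤ φ f
    φ-nonNeg {f} f∈G⁺@(_ , 0≤f) = begin
      0ℚ          ≤⟨ 0≤p⊖q (φ f) (φ 𝟎) ⟩
      φ f ⊖ φ 𝟎   ≡⟨ sym (pres-∸ f∈G⁺ InG⁺-𝟎) ⟩
      φ (f ⊝ 𝟎)   ≡⟨ resp-≈ (InG⁺-⊝ f∈G⁺ InG⁺-𝟎) f∈G⁺ f⊝𝟎≈f ⟩
      φ f         ∎
      where
      open ≤-Reasoning
      f⊝𝟎≈f : (f ⊝ 𝟎) ≈ f
      f⊝𝟎≈f x x∈cube = trans (cong (0ℚ ⊔_) (+-identityʳ (f x))) (p≤q⇒p⊔q≡q (0≤f x x∈cube))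

    φ⊝≡0⇒≤ : ∀ {f g} → InG⁺ f → InG⁺ g → φ (f ⊝ g) ≡ 0ℚ → φ f ≤ φ g
    φ⊝≡0⇒≤ f∈G⁺ g∈G⁺ φ[f⊝g]≡0 = p⊖q≡0⇒p≤q (trans (sym (pres-∸ f∈G⁺ g∈G⁺)) φ[f⊝g]≡0)

    φ-mono : ∀ {f g} → InG⁺ f → InG⁺ g → (∀ x → InCube x → f x ≤ g x) → φ f ≤ φ g
    φ-mono {f} {g} f∈G⁺ g∈G⁺ f≤g = φ⊝≡0⇒≤ f∈G⁺ g∈G⁺
      (trans (resp-≈ (InG⁺-⊝ f∈G⁺ g∈G⁺) InG⁺-𝟎 (λ x x∈cube → p≤q⇒p⊖q≡0 (f≤g x x∈cube))) φ-𝟎)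

    φ-⊛ : ∀ k {f} → InG⁺ f → φ (k ⊛ f) ≡ ιℕ k * φ f
    φ-⊛ zero    {f} f∈G⁺ = trans φ-𝟎 (sym (*-zeroˡ (φ f)))
    φ-⊛ (suc k) {f} f∈G⁺ = begin
      φ (f ⊕ (k ⊛ f))       ≡⟨ pres-+ f∈G⁺ (InG⁺-⊛ k f∈G⁺) ⟩
      φ f + φ (k ⊛ f)       ≡⟨ cong (_+_ (φ f)) (φ-⊛ k f∈G⁺) ⟩
      φ f + ιℕ k * φ f      ≡⟨ p+ιℕk*p≡ιℕ[1+k]*p k (φ f) ⟩
      ιℕ (suc k) * φ f      ∎
      where open ≡-Reasoning

    φ-Σᶠ : ∀ {m} {F : Fin m → Fun d} → (∀ i → InG⁺ (F i)) → φ (Σᶠ F) ≡ Σℚ (λ i → φ (F i))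
    φ-Σᶠ {zero}  F∈G⁺ = φ-𝟎
    φ-Σᶠ {suc m} {F} F∈G⁺ = trans (pres-+ (F∈G⁺ fzero) (InG⁺-Σᶠ (λ i → F∈G⁺ (fsuc i))))
                              (cong (_+_ (φ (F fzero))) (φ-Σᶠ (λ i → F∈G⁺ (fsuc i))))

    φ-∨ᶠ : ∀ {f g} → InG⁺ f → InG⁺ g → φ (f ∨ᶠ g) ≡ φ f ⊔ φ g
    φ-∨ᶠ {f} {g} f∈G⁺ g∈G⁺ = begin
      φ (f ⊕ (g ⊝ f))      ≡⟨ pres-+ f∈G⁺ (InG⁺-⊝ g∈G⁺ f∈G⁺) ⟩
      φ f + φ (g ⊝ f)      ≡⟨ cong (_+_ (φ f)) (pres-∸ g∈G⁺ f∈G⁺) ⟩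
      φ f + φ g ⊖ φ f      ≡⟨ p+[q⊖p]≡p⊔q (φ f) (φ g) ⟩
      φ f ⊔ φ g            ∎
      where open ≡-Reasoning

    φ-⋁ᶠ : ∀ {m} {F : Fin m → Fun d} → (∀ i → InG⁺ (F i)) → φ (⋁ᶠ F) ≡ ⋁ℚ (λ i → φ (F i))
    φ-⋁ᶠ {zero}  F∈G⁺ = φ-𝟎
    φ-⋁ᶠ {suc m} {F} F∈G⁺ = trans (φ-∨ᶠ (F∈G⁺ fzero) (InG⁺-⋁ᶠ (λ i → F∈G⁺ (fsuc i))))
                              (cong (_⊔_ (φ (F fzero))) (φ-⋁ᶠ (λ i → F∈G⁺ (fsuc i))))

    φ-△ : ∀ {f g} → InG⁺ f → InG⁺ g → φ (f △ g) ≡ ∣ φ f - φ g ∣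
    φ-△ {f} {g} f∈G⁺ g∈G⁺ = begin
      φ ((f ⊝ g) ⊕ (g ⊝ f))      ≡⟨ pres-+ (InG⁺-⊝ f∈G⁺ g∈G⁺) (InG⁺-⊝ g∈G⁺ f∈G⁺) ⟩
      φ (f ⊝ g) + φ (g ⊝ f)      ≡⟨ cong₂ _+_ (pres-∸ f∈G⁺ g∈G⁺) (pres-∸ g∈G⁺ f∈G⁺) ⟩
      φ f ⊖ φ g + φ g ⊖ φ f      ≡⟨ sym (∣p-q∣≡p⊖q+q⊖p (φ f) (φ g)) ⟩
      ∣ φ f - φ g ∣              ∎
      where open ≡-Reasoning

    φ-𝟏 : φ 𝟏 ≡ φ xₙ + ⋁ℚ (λ i → φ (xᵢ i))
    φ-𝟏 = begin
      φ 𝟏                      ≡⟨ resp-≈ InG⁺-𝟏 (InG⁺-⊕ InG⁺-xₙ (InG⁺-⋁ᶠ InG⁺-xᵢ)) 𝟏≈xₙ⊕⋁xᵢ ⟩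
      φ (xₙ ⊕ ⋁ᶠ xᵢ)           ≡⟨ pres-+ InG⁺-xₙ (InG⁺-⋁ᶠ InG⁺-xᵢ) ⟩
      φ xₙ + φ (⋁ᶠ xᵢ)         ≡⟨ cong (_+_ (φ xₙ)) (φ-⋁ᶠ InG⁺-xᵢ) ⟩
      φ xₙ + ⋁ℚ (λ i → φ (xᵢ i)) ∎
      where open ≡-Reasoning

  -- A Lipschitz bound at a zero

  upper-bound-over-list : ∀ {A : Set} (P : A → ℚ → Set) → (∀ {a C C′} → C ≤ C′ → P a C → P a C′) →
                          (∀ a → ∃ (P a)) → (L : List A) → ∃[ C ] (∀ {a} → a ∈ L → P a C)
  upper-bound-over-list P mono bound []      = 0ℚ , λ ()
  upper-bound-over-list P mono bound (a ∷ L) with bound a | upper-bound-over-list P mono bound L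
  ... | Cₐ , Pa | C , P-L = Cₐ ⊔ C , bounded
    where
    bounded : ∀ {b} → b ∈ a ∷ L → P b (Cₐ ⊔ C)
    bounded (here refl) = mono (p≤p⊔q Cₐ C) Pa
    bounded (there b∈L) = mono (p≤q⊔p Cₐ C) (P-L b∈L)

  module LipschitzAtZero {d} {q : Point d} (q∈cube : InCube q) {g : Fun d}
                         (uc-g : UniformlyContinuous g) (gq≡0 : g q ≡ 0ℚ) where

    BoundedOn : Affine d → ℚ → Set
    BoundedOn a C = ∀ x → InCube x → g x ≡ evalAffine a x → g x ≤ C * dist x q

    BoundedOn-mono : ∀ {a C C′} → C ≤ C′ → BoundedOn a C → BoundedOn a C′
    BoundedOn-mono C≤C′ bound x x∈cube gx≡ax =
      ≤-trans (bound x x∈cube gx≡ax) (*-monoʳ-≤-nonNeg (dist x q) {{nonNegative (dist-nonNeg x q)}} C≤C′)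

    small-near-q : ∀ {ε} → 0ℚ < ε → ∃[ δ ] (0ℚ < δ × ∀ x → InCube x → dist x q < δ → g x < ε)
    small-near-q {ε} 0<ε with uc-g ε 0<ε
    ... | δ , 0<δ , close = δ , 0<δ , λ x x∈cube near → begin-strict
      g x            ≡⟨ sym (trans (cong (_-_ (g x)) gq≡0) (+-identityʳ (g x))) ⟩
      g x - g q      ≤⟨ p≤∣p∣ (g x - g q) ⟩
      ∣ g x - g q ∣  <⟨ close x q x∈cube q∈cube (λ i → ≤-<-trans (∣xᵢ-yᵢ∣≤dist x q i) near) ⟩
      ε              ∎
      where open ≤-Reasoning

    on-piece-upper : ∀ a {x} → g x ≡ evalAffine a x → g x ≤ evalAffine a q + ‖ a ‖ * dist x q
    on-piece-upper a {x} gx≡ax = subst (_≤ evalAffine a q + ‖ a ‖ * dist x q) (sym gx≡ax) (affine-upper a x q)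

    on-piece-below-half : ∀ a {x} → g x ≡ evalAffine a x → g x < evalAffine a q * ½ → g x ≤ ‖ a ‖ * dist x q
    on-piece-below-half a {x} gx≡ax gx<aq/2 = <⇒≤ (p<r*½⇒r≤p+s⇒p<s gx<aq/2 aq≤gx+‖a‖*dist)
      where
      aq≤gx+‖a‖*dist : evalAffine a q ≤ g x + ‖ a ‖ * dist x q
      aq≤gx+‖a‖*dist = subst (λ v → evalAffine a q ≤ v + ‖ a ‖ * dist x q) (sym gx≡ax) (affine-lower a x q)

    nonPositive-piece-bound : ∀ a → evalAffine a q ≤ 0ℚ → BoundedOn a ‖ a ‖
    nonPositive-piece-bound a aq≤0 x _ gx≡ax = begin
      g x                                ≤⟨ on-piece-upper a gx≡ax ⟩
      evalAffine a q + ‖ a ‖ * dist x q  ≤⟨ +-monoˡ-≤ (‖ a ‖ * dist x q) aq≤0 ⟩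
      0ℚ + ‖ a ‖ * dist x q              ≡⟨ +-identityˡ (‖ a ‖ * dist x q) ⟩
      ‖ a ‖ * dist x q                   ∎
      where open ≤-Reasoning

    -- Near q, continuity of g at its zero gives g x < a(q) / 2 while a(q) ≤ g x + ‖a‖ · dist,
    -- so g x ≤ ‖a‖ · dist; at distance at least δ from q, a(q) ≤ (a(q) / δ) · dist.
    positive-piece-bound : ∀ a → 0ℚ < evalAffine a q → ∃ (BoundedOn a)
    positive-piece-bound a 0<aq with small-near-q (0<p⇒0<p*½ 0<aq)
    ... | δ , 0<δ , small = ‖ a ‖ + w , bound
      where
      open ≤-Reasoning
      aq = evalAffine a q
      instance
        δ-positive : Positive δ
        δ-positive = positive 0<δ
        δ-nonZero : NonZero δ
        δ-nonZero = pos⇒nonZero δ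
      w = aq * 1/ δ
      instance
        w-nonNeg : NonNegative w
        w-nonNeg = pos⇒nonNeg w {{pos*pos⇒pos aq {{positive 0<aq}} (1/ δ) {{1/pos⇒pos δ}}}}
      w*δ≡aq : w * δ ≡ aq
      w*δ≡aq = trans (*-assoc aq (1/ δ) δ) (trans (cong (_*_ aq) (*-inverseˡ δ)) (*-identityʳ aq))

      bound : BoundedOn a (‖ a ‖ + w)
      bound x x∈cube gx≡ax with dist x q <? δ
      ... | yes near = begin
        g x                     ≤⟨ on-piece-below-half a gx≡ax (small x x∈cube near) ⟩
        ‖ a ‖ * dist x q        ≤⟨ *-monoʳ-≤-nonNeg (dist x q) {{nonNegative (dist-nonNeg x q)}} ‖a‖≤‖a‖+w ⟩
        (‖ a ‖ + w) * dist x q  ∎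
        where
        ‖a‖≤‖a‖+w : ‖ a ‖ ≤ ‖ a ‖ + w
        ‖a‖≤‖a‖+w = ≤-trans (≤-reflexive (sym (+-identityʳ ‖ a ‖))) (+-monoʳ-≤ ‖ a ‖ (nonNegative⁻¹ w))
      ... | no far = begin
        g x                              ≤⟨ on-piece-upper a gx≡ax ⟩
        aq + ‖ a ‖ * dist x q            ≤⟨ +-monoˡ-≤ (‖ a ‖ * dist x q) aq≤w*dist ⟩
        w * dist x q + ‖ a ‖ * dist x q  ≡⟨ sym (*-distribʳ-+ (dist x q) w ‖ a ‖) ⟩
        (w + ‖ a ‖) * dist x q           ≡⟨ cong (_* dist x q) (+-comm w ‖ a ‖) ⟩
        (‖ a ‖ + w) * dist x q           ∎
        where
        aq≤w*dist : aq ≤ w * dist x q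
        aq≤w*dist = begin
          aq            ≡⟨ sym w*δ≡aq ⟩
          w * δ         ≤⟨ *-monoˡ-≤-nonNeg w (≮⇒≥ far) ⟩
          w * dist x q  ∎

    piece-bound : ∀ a → ∃ (BoundedOn a)
    piece-bound a with evalAffine a q ≤? 0ℚ
    ... | yes aq≤0 = ‖ a ‖ , nonPositive-piece-bound a aq≤0
    ... | no aq≰0  = positive-piece-bound a (≰⇒> aq≰0)

    lipschitz-at-zero : PiecewiseIntegerLinear g → ∃[ C ] (∀ x → InCube x → g x ≤ C * dist x q)
    lipschitz-at-zero (pieces , g-on-pieces)
      with upper-bound-over-list BoundedOn (λ {a} → BoundedOn-mono {a}) piece-bound pieces
    ... | C , bounded = C , bound
      where
      bound : ∀ x → InCube x → g x ≤ C * dist x q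
      bound x x∈cube with g-on-pieces x x∈cube
      ... | a , a∈pieces , gx≡ax = bounded a∈pieces x x∈cube gx≡ax

  -- Hoop homomorphisms are scaled evaluations

  module Representation {d} {φ : Fun d → ℚ} (hom : IsHoopHom φ)
                        {Λ : ℚ} (0<Λ : 0ℚ < Λ) (φ𝟏≡Λ : φ 𝟏 ≡ Λ)
                        {q : Point d} (φxᵢ≡Λqᵢ : ∀ i → φ (xᵢ i) ≡ Λ * q i) where
    open HoopHom hom

    instance
      Λ-positive : Positive Λ
      Λ-positive = positive 0<Λ

    q∈cube : InCube q
    q∈cube i = *-cancelˡ-≤-pos Λ 0≤Λqᵢ , *-cancelˡ-≤-pos Λ Λqᵢ≤Λ
      where
      open ≤-Reasoning
      0≤Λqᵢ : Λ * 0ℚ ≤ Λ * q i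
      0≤Λqᵢ = begin
        Λ * 0ℚ    ≡⟨ *-zeroʳ Λ ⟩
        0ℚ        ≤⟨ φ-nonNeg (InG⁺-xᵢ i) ⟩
        φ (xᵢ i)  ≡⟨ φxᵢ≡Λqᵢ i ⟩
        Λ * q i   ∎
      Λqᵢ≤Λ : Λ * q i ≤ Λ * 1ℚ
      Λqᵢ≤Λ = begin
        Λ * q i   ≡⟨ sym (φxᵢ≡Λqᵢ i) ⟩
        φ (xᵢ i)  ≤⟨ φ-mono (InG⁺-xᵢ i) InG⁺-𝟏 (λ x x∈cube → proj₂ (x∈cube i)) ⟩
        φ 𝟏       ≡⟨ φ𝟏≡Λ ⟩
        Λ         ≡⟨ sym (*-identityʳ Λ) ⟩
        Λ * 1ℚ    ∎

    record NullMajorant (u : Point d → ℚ) : Set where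
      field
        h         : Fun d
        h∈G⁺      : InG⁺ h
        φh≡0      : φ h ≡ 0ℚ
        majorizes : ∀ x → InCube x → u x ≤ h x

    -- With r = m / N, the function |N · f - m · 𝟏| dominates |f - r| and φ sends it to 0.
    level-majorant : ∀ {f r} → InG⁺ f → 0ℚ ≤ r → φ f ≡ Λ * r → NullMajorant (λ x → ∣ f x - r ∣)
    level-majorant {f} {r} f∈G⁺ 0≤r φf≡Λr with nonNeg-fraction r 0≤r
    ... | k , m , Nr≡m = record
      { h         = (suc k ⊛ f) △ (m ⊛ 𝟏)
      ; h∈G⁺      = InG⁺-△ (InG⁺-⊛ (suc k) f∈G⁺) (InG⁺-⊛ m InG⁺-𝟏)
      ; φh≡0      = φh≡0
      ; majorizes = majorizes
      }
      where
      N = ιℕ (suc k)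
      φh≡0 : φ ((suc k ⊛ f) △ (m ⊛ 𝟏)) ≡ 0ℚ
      φh≡0 = begin
        φ ((suc k ⊛ f) △ (m ⊛ 𝟏))      ≡⟨ φ-△ (InG⁺-⊛ (suc k) f∈G⁺) (InG⁺-⊛ m InG⁺-𝟏) ⟩
        ∣ φ (suc k ⊛ f) - φ (m ⊛ 𝟏) ∣  ≡⟨ cong₂ (λ u v → ∣ u - v ∣) (φ-⊛ (suc k) f∈G⁺) (φ-⊛ m InG⁺-𝟏) ⟩
        ∣ N * φ f - ιℕ m * φ 𝟏 ∣       ≡⟨ cong₂ (λ u v → ∣ N * u - v ∣) φf≡Λr (cong₂ _*_ (sym Nr≡m) φ𝟏≡Λ) ⟩
        ∣ N * (Λ * r) - N * r * Λ ∣    ≡⟨ cong ∣_∣ (solve 3 (λ n l r → n :* (l :* r) :- n :* r :* l := con 0ℚ)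
                                                   refl N Λ r) ⟩
        ∣ 0ℚ ∣                         ≡⟨⟩
        0ℚ                             ∎
        where open ≡-Reasoning
              open ℚ-Solver
      majorizes : ∀ x → InCube x → ∣ f x - r ∣ ≤ ((suc k ⊛ f) △ (m ⊛ 𝟏)) x
      majorizes x _ = begin
        ∣ f x - r ∣                    ≡⟨ sym (*-identityˡ ∣ f x - r ∣) ⟩
        1ℚ * ∣ f x - r ∣               ≤⟨ *-monoʳ-≤-nonNeg ∣ f x - r ∣ {{∣-∣-nonNeg (f x - r)}} (1≤ιℕ-suc k) ⟩
        N * ∣ f x - r ∣                ≡⟨ cong (_* ∣ f x - r ∣) (sym (0≤p⇒∣p∣≡p (0≤ιℕ (suc k)))) ⟩
        ∣ N ∣ * ∣ f x - r ∣            ≡⟨ sym (∣p*q∣≡∣p∣*∣q∣ N (f x - r)) ⟩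
        ∣ N * (f x - r) ∣              ≡⟨ cong ∣_∣ (solve 3 (λ n u r → n :* (u :- r) := n :* u :- n :* r :* con 1ℚ)
                                                   refl N (f x) r) ⟩
        ∣ N * f x - N * r * 1ℚ ∣       ≡⟨ cong₂ (λ u v → ∣ u - v * 1ℚ ∣) (sym (⊛-pointwise (suc k) f x)) Nr≡m ⟩
        ∣ (suc k ⊛ f) x - ιℕ m * 1ℚ ∣  ≡⟨ cong (λ v → ∣ (suc k ⊛ f) x - v ∣) (sym (⊛-pointwise m 𝟏 x)) ⟩
        ∣ (suc k ⊛ f) x - (m ⊛ 𝟏) x ∣  ≡⟨ sym (△-pointwise (suc k ⊛ f) (m ⊛ 𝟏) x) ⟩
        ((suc k ⊛ f) △ (m ⊛ 𝟏)) x      ∎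
        where open ≤-Reasoning
              open ℚ-Solver

    distance-majorant : NullMajorant (λ x → dist x q)
    distance-majorant = record
      { h         = Σᶠ (λ i → h (coordinate i))
      ; h∈G⁺      = InG⁺-Σᶠ (λ i → h∈G⁺ (coordinate i))
      ; φh≡0      = trans (φ-Σᶠ (λ i → h∈G⁺ (coordinate i))) (Σℚ-zero (λ i → φh≡0 (coordinate i)))
      ; majorizes = λ x x∈cube → ≤-trans (Σℚ-mono-≤ (λ i → majorizes (coordinate i) x x∈cube))
                                         (≤-reflexive (sym (Σᶠ-pointwise (λ i → h (coordinate i)) x)))
      }
      where
      open NullMajorant
      coordinate : ∀ i → NullMajorant (λ x → ∣ x i - q i ∣)
      coordinate i = level-majorant (InG⁺-xᵢ i) (proj₁ (q∈cube i)) (φxᵢ≡Λqᵢ i)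

    φ-vanishes-under-distance : ∀ {g} L → InG⁺ g → (∀ x → InCube x → g x ≤ ιℕ L * dist x q) → φ g ≡ 0ℚ
    φ-vanishes-under-distance {g} L g∈G⁺ g≤L*dist = ≤-antisym φg≤0 (φ-nonNeg g∈G⁺)
      where
      open NullMajorant distance-majorant
      open ≤-Reasoning
      g≤L⊛h : ∀ x → InCube x → g x ≤ (L ⊛ h) x
      g≤L⊛h x x∈cube = begin
        g x              ≤⟨ g≤L*dist x x∈cube ⟩
        ιℕ L * dist x q  ≤⟨ *-monoˡ-≤-nonNeg (ιℕ L) {{nonNegative (0≤ιℕ L)}} (majorizes x x∈cube) ⟩
        ιℕ L * h x       ≡⟨ sym (⊛-pointwise L h x) ⟩
        (L ⊛ h) x        ∎
      φg≤0 : φ g ≤ 0ℚ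
      φg≤0 = begin
        φ g           ≤⟨ φ-mono g∈G⁺ (InG⁺-⊛ L h∈G⁺) g≤L⊛h ⟩
        φ (L ⊛ h)     ≡⟨ φ-⊛ L h∈G⁺ ⟩
        ιℕ L * φ h    ≡⟨ cong (_*_ (ιℕ L)) φh≡0 ⟩
        ιℕ L * 0ℚ     ≡⟨ *-zeroʳ (ιℕ L) ⟩
        0ℚ            ∎

    φ-vanishes : ∀ {g} → InG⁺ g → g q ≡ 0ℚ → φ g ≡ 0ℚ
    φ-vanishes {g} g∈G⁺@((pil-g , uc-g) , _) gq≡0 = φ-vanishes-under-distance L g∈G⁺ g≤L*dist
      where
      lipschitz : ∃[ C ] (∀ x → InCube x → g x ≤ C * dist x q)
      lipschitz = LipschitzAtZero.lipschitz-at-zero q∈cube uc-g gq≡0 pil-g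
      C = proj₁ lipschitz
      L = proj₁ (archimedean C)
      g≤L*dist : ∀ x → InCube x → g x ≤ ιℕ L * dist x q
      g≤L*dist x x∈cube = ≤-trans (proj₂ lipschitz x x∈cube)
        (*-monoʳ-≤-nonNeg (dist x q) {{nonNegative (dist-nonNeg x q)}} (proj₂ (archimedean C)))

    φ-mono-at-q : ∀ {f g} → InG⁺ f → InG⁺ g → f q ≤ g q → φ f ≤ φ g
    φ-mono-at-q f∈G⁺ g∈G⁺ fq≤gq =
      φ⊝≡0⇒≤ f∈G⁺ g∈G⁺ (φ-vanishes (InG⁺-⊝ f∈G⁺ g∈G⁺) (p≤q⇒p⊖q≡0 fq≤gq))

    φ-cong-at-q : ∀ {f g} → InG⁺ f → InG⁺ g → f q ≡ g q → φ f ≡ φ g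
    φ-cong-at-q f∈G⁺ g∈G⁺ fq≡gq =
      ≤-antisym (φ-mono-at-q f∈G⁺ g∈G⁺ (≤-reflexive fq≡gq))
                (φ-mono-at-q g∈G⁺ f∈G⁺ (≤-reflexive (sym fq≡gq)))

    φ≡Λ*eval : ∀ {f} → InG⁺ f → φ f ≡ Λ * f q
    φ≡Λ*eval {f} f∈G⁺ = *-cancelˡ-≡-pos N {{N-positive}} (begin
      N * φ f         ≡⟨ sym (φ-⊛ (suc k) f∈G⁺) ⟩
      φ (suc k ⊛ f)   ≡⟨ φ-cong-at-q (InG⁺-⊛ (suc k) f∈G⁺) (InG⁺-⊛ m InG⁺-𝟏) agree-at-q ⟩
      φ (m ⊛ 𝟏)       ≡⟨ φ-⊛ m InG⁺-𝟏 ⟩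
      ιℕ m * φ 𝟏      ≡⟨ cong₂ _*_ (sym Nfq≡m) φ𝟏≡Λ ⟩
      (N * f q) * Λ   ≡⟨ solve 3 (λ n u l → (n :* u) :* l := n :* (l :* u)) refl N (f q) Λ ⟩
      N * (Λ * f q)   ∎)
      where
      open ≡-Reasoning
      open ℚ-Solver
      fraction = nonNeg-fraction (f q) (proj₂ f∈G⁺ q q∈cube)
      k = proj₁ fraction
      m = proj₁ (proj₂ fraction)
      N = ιℕ (suc k)
      N-positive : Positive N
      N-positive = normalize-pos (suc k) 1
      Nfq≡m : N * f q ≡ ιℕ m
      Nfq≡m = proj₂ (proj₂ fraction)
      agree-at-q : (suc k ⊛ f) q ≡ (m ⊛ 𝟏) q
      agree-at-q = begin
        (suc k ⊛ f) q  ≡⟨ ⊛-pointwise (suc k) f q ⟩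
        N * f q        ≡⟨ Nfq≡m ⟩
        ιℕ m           ≡⟨ sym (*-identityʳ (ιℕ m)) ⟩
        ιℕ m * 1ℚ      ≡⟨ sym (⊛-pointwise m 𝟏 q) ⟩
        (m ⊛ 𝟏) q      ∎

  strongUnit-positive : ∀ {d} {u : Fun d} → IsStrongUnit u → ∀ {p} → InCube p → 0ℚ < u p
  strongUnit-positive {u = u} (k , 1≤k*u) {p} p∈cube = ≰⇒> up≰0
    where
    up≰0 : u p ≰ 0ℚ
    up≰0 up≤0 = <-irrefl refl (begin-strict
      0ℚ           <⟨ positive⁻¹ 1ℚ ⟩
      1ℚ           ≤⟨ 1≤k*u p p∈cube ⟩
      ιℕ k * u p   ≤⟨ *-monoˡ-≤-nonNeg (ιℕ k) {{nonNegative (0≤ιℕ k)}} up≤0 ⟩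
      ιℕ k * 0ℚ    ≡⟨ *-zeroʳ (ιℕ k) ⟩
      0ℚ           ∎)
      where open ≤-Reasoning

  *-/′-cancel : ∀ a {b} → b ≢ 0ℚ → b * (a /' b) ≡ a
  *-/′-cancel a {b} b≢0 with b ≟ 0ℚ
  ... | yes b≡0 = contradiction b≡0 b≢0
  ... | no b≢0′ = begin
    b * (a * 1/ b)   ≡⟨ solve 3 (λ b a c → b :* (a :* c) := a :* (b :* c)) refl b a (1/ b) ⟩
    a * (b * 1/ b)   ≡⟨ cong (_*_ a) (*-inverseʳ b) ⟩
    a * 1ℚ           ≡⟨ *-identityʳ a ⟩
    a                ∎
    where
    open ≡-Reasoning
    open ℚ-Solver
    instance
      b-nonZero : NonZero b
      b-nonZero = ≢-nonZero b≢0′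

  module _ {d} {σ : Fun d → Fun d} (endo : IsHoopEndo σ) {p : Point d} (p∈cube : InCube p) where

    σ𝟏≡f♯ : σ 𝟏 p ≡ f♯ σ p
    σ𝟏≡f♯ = HoopHom.φ-𝟏 (endo-at-point endo p∈cube)

    f♯-positive : IsNontrivial σ → 0ℚ < f♯ σ p
    f♯-positive nontrivial =
      subst (0ℚ <_) σ𝟏≡f♯ (strongUnit-positive (nontrivial 𝟏 InG⁺-𝟏 (1 , λ _ _ → ≤-refl)) p∈cube)

    σxᵢ≡f♯*S : IsNontrivial σ → ∀ i → σ (xᵢ i) p ≡ f♯ σ p * S σ p i
    σxᵢ≡f♯*S nontrivial i =
      sym (*-/′-cancel (σ (xᵢ i) p) (≢-sym (<⇒≢ (f♯-positive nontrivial))))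

open import Defs
open import Data.Nat using (ℕ; _≤_; _∸_)
open import Data.Rational using (_*_)
open McNaughtonCone using (endo-at-point; module Representation; σ𝟏≡f♯; f♯-positive; σxᵢ≡f♯*S)

corollary3p4 : (n : ℕ) → 2 ≤ n → (σ : Fun (n ∸ 1) → Fun (n ∸ 1)) → IsHoopEndo σ → IsNontrivial σ → ∀ f → InG⁺ f → σ f ≈ (λ p → f♯ σ p * f (S σ p))
corollary3p4 _ _ σ endo nontrivial f f∈G⁺ p p∈cube =
  Representation.φ≡Λ*eval (endo-at-point endo p∈cube)
    (f♯-positive endo p∈cube nontrivial) (σ𝟏≡f♯ endo p∈cube) (σxᵢ≡f♯*S endo p∈cube nontrivial) f∈G⁺
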